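{- Let $\mathbf J$, $\varphi$ and $K$ be the maps of $\mathbb{Q}\cap(0,1)$ defined in the context. Then $\mathbf J\circ\varphi=\varphi\circ\mathbf J$ and $\mathbf J\circ K=K\circ\mathbf J$.
   Context: Continued fractions: $[0,a_1,\dots,a_m]=1/(a_1+1/(\cdots+1/a_m))$. Every $r\in\mathbb{Q}\cap(0,1)$ has a unique expansion $r=[0,n_1,\dots,n_k]$ with positive integers $n_i$ and $n_k\ge 2$. Write $1_m$ for a block of $m$ entries equal to $1$. The map $\mathbf J:\mathbb{Q}\cap(0,1)\to\mathbb{Q}\cap(0,1)$ is defined as follows. For $r=[0,n_1,\dots,n_k]$ with $n_k\ge2$ and $k\ge2$, first form $$[0,1_{n_1-1},2,1_{n_2-2},2,\dots,1_{n_{k-1}-2},2,1_{n_k-1}].$$ Then reduce it, one rule at a time, until all entries are $\ge 1$, using two rules: - a block $1_0$ is deleted; - a block $1_{ -1}$ between entries $m$ and $n$ merges them into the single entry $m+n-1$. The result is $\mathbf J(r)$. For $k=1$, $\mathbf J([0,n_1])=[0,1_{n_1-1}]$ (a continued fraction of $n_1-1$ ones). For example, $\mathbf J(1/2)=1/2$, $\mathbf J(1/3)=2/3$ and $\mathbf J(2/3)=1/3$. The flip is $\varphi([0,n_1,n_2,\dots,n_k])=[0,n_k-1,n_{k-1},\dots,n_2,n_1+1]$ for $n_k\ge2$, where a leading entry $n_k-1=0$ is interpreted by the usual convention. Equivalently, via $\theta(n_1,\dots,n_k)=[0,n_1,\dots,n_k+1]$, the map $\varphi$ corresponds to reversing the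 tuple $(n_1,\dots,n_k)\mapsto(n_k,\dots,n_1)$. $K(x)=1-x$. -}

module Defs where

open import Data.Nat using (ℕ; zero; suc; _+_; _*_; _∸_)
open import Data.Nat.DivMod using (_/_; _%_)
open import Data.Integer using (ℤ; +_; -[1+_]; _⊖_; ∣_∣)
open import Data.List using (List; []; _∷_; _++_; replicate; reverse)
open import Data.Product using (_×_; _,_)
open import Data.Rational using (ℚ; 0ℚ; 1ℚ; _-_; ↥_; ↧ₙ_)
import Data.Rational as Q

-- Continued fractions [0, a₁, …, aₘ] represented by the list (a₁ … aₘ).

-- numerator / denominator of [0, a₁, …, aₘ]:  [0] = 0/1,
-- [0, a, as…] = 1 / (a + p/q) = q / (a*q + p)  where p/q = [0, as…]
cfFrac : List ℕ → ℕ × ℕ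
cfFrac [] = 0 , 1
cfFrac (a ∷ as) with cfFrac as
... | p , q = q , a * q + p

-- p / q as an element of ℚ (the denominator 0 never arises for
-- lists of positive entries; it is sent to 0 by convention)
ratio : ℕ → ℕ → ℚ
ratio p zero = 0ℚ
ratio p (suc d) = (+ p) Q./ suc d

cfVal : List ℕ → ℚ
cfVal as with cfFrac as
... | p , q = ratio p q

-- Euclidean algorithm: the expansion of p/q (fuel-bounded; fuel q suffices).
-- For 0 < p < q this is the unique expansion (n₁ … n_k) with n_k ≥ 2.
expand : ℕ → ℕ → ℕ → List ℕ
expand zero p q = []
expand (suc f) zero q = []
expand (suc f) (suc p) q = (q / suc p) ∷ expand f (q % suc p) (suc p)

cf : ℚ → List ℕ
cf r = expand (↧ₙ r) ∣ ↥ r ∣ (↧ₙ r)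

-- tokens of the intermediate word: an entry, or a block 1_m with m ∈ ℤ
data Tok : Set where
  ent  : ℕ → Tok
  ones : ℤ → Tok

buildTail : ℕ → List ℕ → List Tok
buildTail n [] = ones (n ⊖ 1) ∷ []
buildTail n (m ∷ ms) = ones (n ⊖ 2) ∷ ent 2 ∷ buildTail m ms

-- the word [0, 1_{n₁-1}, 2, 1_{n₂-2}, 2, …, 1_{n_{k-1}-2}, 2, 1_{n_k-1}]  (k ≥ 2)
build : ℕ → ℕ → List ℕ → List Tok
build n₁ n₂ ns = ones (n₁ ⊖ 1) ∷ ent 2 ∷ buildTail n₂ ns

-- reduction: 1_0 is deleted, 1_m (m ≥ 0) expands to m ones, and
-- 1_{-1} between entries m and n merges them into m + n - 1.
-- (Blocks 1_{-1} only occur between two entries; the merge rule is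
-- associative, so the left-to-right order used here is immaterial.)
mutual
  reduce : List Tok → List ℕ
  reduce [] = []
  reduce (ent m ∷ rest) = reduceE m rest
  reduce (ones (+ k) ∷ rest) = replicate k 1 ++ reduce rest
  reduce (ones -[1+ _ ] ∷ rest) = reduce rest

  -- pending entry m, which may still be merged with a following entry
  reduceE : ℕ → List Tok → List ℕ
  reduceE m (ones -[1+ zero ] ∷ ent n ∷ rest) = reduceE (m + n ∸ 1) rest
  reduceE m rest = m ∷ reduce rest

Jcf : List ℕ → List ℕ
Jcf [] = []
Jcf (n₁ ∷ []) = replicate n₁ 1
Jcf (n₁ ∷ n₂ ∷ ns) = reduce (build n₁ n₂ ns)

J : ℚ → ℚ
J r = cfVal (Jcf (cf r))

-- The flip φ, via θ(n₁,…,n_k) = [0, n₁, …, n_k + 1]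

θinv : List ℕ → List ℕ
θinv [] = []
θinv (n ∷ []) = (n ∸ 1) ∷ []
θinv (n ∷ m ∷ ms) = n ∷ θinv (m ∷ ms)

θ : List ℕ → List ℕ
θ [] = []
θ (n ∷ []) = suc n ∷ []
θ (n ∷ m ∷ ms) = n ∷ θ (m ∷ ms)

φcf : List ℕ → List ℕ
φcf ns = θ (reverse (θinv ns))

φ : ℚ → ℚ
φ r = cfVal (φcf (cf r))

K : ℚ → ℚ
K x = 1ℚ - x

-- In the coordinates θ (m₁, …, m_k) = [0, m₁, …, m_k + 1] of canonical expansions, φ is the
-- reversal of (m₁, …, m_k), and the word defining J ends in the block 1_{m_k}: it is the word
-- 1_{m₁-1} 2 1_{m₂-2} 2 ⋯ 2 1_{m_k-1} followed by a single 1, so J (θ m) = θ (reduct of that word).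
-- After the merges the word is a concatenation of chunks 1 and 2 1₋₁ 2 ⋯ 1₋₁ 2, each a palindrome
-- reducing to a single entry; hence reversing m reverses the reduct, which is J ∘ φ = φ ∘ J.
-- On expansions K exchanges [0, 1, b, …] and [0, b + 1, …], and comparing the leading blocks of the
-- two words shows that J commutes with this exchange; only 1/2 is settled by computation.

module Submission where

module Expansions where

  open import Data.Nat using (ℕ; zero; suc; _+_; _*_; _∸_; _≤_; _<_; z≤n; s≤s; NonZero)
  open import Data.Nat.Properties
    using (+-identityʳ; *-identityʳ; *-identityˡ; +-assoc; +-comm; *-comm; *-zeroʳ; *-distribˡ-+; m+n∸m≡n
          ; <-trans; ≤-trans; ≤-<-trans; <-≤-trans; <⇒≤; ≤-pred; ≮⇒≥; <⇒≱; m≤m+n; m≤n*m; m<m+n; *-monoˡ-≤; module ≤-Reasoning)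
  open import Data.Nat.DivMod using (_/_; _%_; m≡m%n+[m/n]*n; +-distrib-/-∣ˡ; m*n/n≡m; m<n⇒m/n≡0; [m+kn]%n≡m%n; m<n⇒m%n≡m; m%n<n; m≥n⇒m/n>0)
  open import Data.Nat.Divisibility using (n∣m*n)
  open import Data.Nat.Coprimality using (Coprime; coprime-+; 1-coprimeTo) renaming (sym to coprime-sym)
  open import Data.Nat.Tactic.RingSolver using (solve-∀)
  open import Data.Integer using (+_; +<+) renaming (_*_ to _*ℤ_; _+_ to _+ℤ_; -_ to -ℤ_)
  import Data.Integer.Properties as ℤ
  open import Data.Integer.Tactic.RingSolver using () renaming (solve-∀ to solve-∀ℤ)
  open import Data.List using (List; []; _∷_; _∷ʳ_)
  open import Data.List.Relation.Unary.All using (All; []; _∷_)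
  open import Data.Product using (_×_; _,_; proj₁; proj₂)
  open import Data.Rational using (ℚ; mkℚ; 0ℚ; 1ℚ; toℚᵘ; _-_; -_; *<*) renaming (_<_ to _<ℚ_)
  import Data.Rational.Properties as ℚ
  open import Data.Rational.Unnormalised using (mkℚᵘ; *≡*; 1ℚᵘ; ↥_; ↧_) renaming (_+_ to _+ᵘ_; -_ to -ᵘ_)
  import Data.Rational.Unnormalised.Properties as ℚᵘ
  open import Relation.Binary.PropositionalEquality hiding (J)
  open import Defs

  cfNum cfDen : List ℕ → ℕ
  cfNum l = proj₁ (cfFrac l)
  cfDen l = proj₂ (cfFrac l)

  data Canonical : List ℕ → Set where
    [_] : ∀ {a} → 2 ≤ a → Canonical (a ∷ [])
    _∷_ : ∀ {a l} → 1 ≤ a → Canonical l → Canonical (a ∷ l)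

  data Positive : List ℕ → Set where
    _∷_ : ∀ {a l} → 1 ≤ a → All (1 ≤_) l → Positive (a ∷ l)

  cfFrac-bounds : ∀ {l} → Canonical l → 0 < cfNum l × cfNum l < cfDen l
  cfFrac-bounds ([_] {a} 2≤a) = s≤s z≤n , subst (1 <_) (sym (trans (+-identityʳ (a * 1)) (*-identityʳ a))) 2≤a
  cfFrac-bounds (_∷_ {suc a} {l} _ v) with cfFrac-bounds v
  ... | 0<p , p<q = <-trans 0<p p<q , ≤-<-trans (m≤n*m (cfDen l) (suc a)) (m<m+n (suc a * cfDen l) 0<p)

  coprime-*+ : ∀ a {p q} → Coprime p q → Coprime (a * q + p) q
  coprime-*+ zero c = c
  coprime-*+ (suc a) {p} {q} c = subst (λ n → Coprime n q) (sym (+-assoc q (a * q) p)) (coprime-+ (coprime-*+ a c))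

  cfFrac-coprime : ∀ l → Coprime (cfNum l) (cfDen l)
  cfFrac-coprime [] = coprime-sym (1-coprimeTo 0)
  cfFrac-coprime (a ∷ l) = coprime-sym (coprime-*+ a (cfFrac-coprime l))

  *+-divMod : ∀ a p q .{{_ : NonZero q}} → p < q → (a * q + p) / q ≡ a × (a * q + p) % q ≡ p
  *+-divMod a p q p<q =
    trans (+-distrib-/-∣ˡ p (n∣m*n a)) (trans (cong₂ _+_ (m*n/n≡m a q) (m<n⇒m/n≡0 p<q)) (+-identityʳ a)) ,
    trans (cong (_% q) (+-comm (a * q) p)) (trans ([m+kn]%n≡m%n p a q) (m<n⇒m%n≡m p<q))

  expand-zero : ∀ f q → expand f 0 q ≡ []
  expand-zero zero q = refl
  expand-zero (suc f) q = refl

  expand-*+ : ∀ f a p q → p < q → expand (suc f) q (a * q + p) ≡ a ∷ expand f p q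
  expand-*+ f a p (suc q) p<q with *+-divMod a p (suc q) p<q
  ... | quot , rem = cong₂ _∷_ quot (cong (λ r → expand f r (suc q)) rem)

  expand-cfFrac : ∀ {l} → Canonical l → ∀ f → cfNum l < f → expand f (cfNum l) (cfDen l) ≡ l
  expand-cfFrac ([_] {a} _) (suc f) _ = trans (expand-*+ f a 0 1 (s≤s z≤n)) (cong (a ∷_) (expand-zero f 1))
  expand-cfFrac (_∷_ {a} {l} _ v) (suc f) (s≤s q≤f) with cfFrac-bounds v
  ... | _ , p<q = trans (expand-*+ f a (cfNum l) (cfDen l) p<q) (cong (a ∷_) (expand-cfFrac v f (<-≤-trans p<q q≤f)))

  cf-ratio : ∀ p q → 0 < q → Coprime p q → cf (ratio p q) ≡ expand q p q
  cf-ratio p (suc q) _ c = cong cf (ℚ.normalize-coprime c)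

  cf-cfVal : ∀ {l} → Canonical l → cf (cfVal l) ≡ l
  cf-cfVal {l} v with cfFrac-bounds v
  ... | 0<p , p<q = trans (cf-ratio (cfNum l) (cfDen l) (<-trans 0<p p<q) (cfFrac-coprime l)) (expand-cfFrac v (cfDen l) p<q)

  2≤quotient : ∀ {q n} .{{_ : NonZero n}} → n < q → q % n ≡ 0 → 2 ≤ q / n
  2≤quotient {q} {n} n<q divides = ≮⇒≥ λ q/n<2 → <⇒≱ n<q (begin
    q                 ≡⟨ m≡m%n+[m/n]*n q n ⟩
    q % n + q / n * n ≡⟨ cong (_+ q / n * n) divides ⟩
    q / n * n         ≤⟨ *-monoˡ-≤ n (≤-pred q/n<2) ⟩
    1 * n             ≡⟨ *-identityˡ n ⟩
    n                 ∎)
    where open ≤-Reasoning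

  expand-canonical : ∀ f p q → 0 < p → p < q → p ≤ f → Canonical (expand f p q)
  expand-canonical (suc f) (suc p) q _ p<q p≤f with q % suc p in rem
  ... | zero rewrite expand-zero f (suc p) = [ 2≤quotient p<q rem ]
  ... | suc r = m≥n⇒m/n>0 (<⇒≤ p<q) ∷
    subst (λ r → Canonical (expand f r (suc p))) rem
      (expand-canonical f (q % suc p) (suc p) (subst (0 <_) (sym rem) (s≤s z≤n)) (m%n<n q (suc p))
        (≤-pred (≤-trans (m%n<n q (suc p)) p≤f)))

  cross-step : ∀ u v P A B → u * B ≡ P * A → P * (v * B + A) ≡ (u + v * P) * B
  cross-step u v P A B uB≡PA = begin
    P * (v * B + A)       ≡⟨ *-distribˡ-+ P (v * B) A ⟩
    P * (v * B) + P * A   ≡⟨ cong (λ x → P * (v * B) + x) uB≡PA ⟨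
    P * (v * B) + u * B   ≡⟨ rearrange u v P B ⟩
    (u + v * P) * B       ∎
    where
    open ≡-Reasoning
    rearrange : ∀ u v P B → P * (v * B) + u * B ≡ (u + v * P) * B
    rearrange = solve-∀

  expand-cross : ∀ f p q → p ≤ f → p * cfDen (expand f p q) ≡ q * cfNum (expand f p q)
  expand-cross f zero q _ rewrite expand-zero f q = sym (*-zeroʳ q)
  expand-cross (suc f) (suc p) q (s≤s p≤f) =
    trans (cross-step (q % suc p) (q / suc p) (suc p) _ _
            (expand-cross f (q % suc p) (suc p) (≤-pred (≤-trans (m%n<n q (suc p)) (s≤s p≤f)))))
          (cong (_* cfDen (expand f (q % suc p) (suc p))) (sym (m≡m%n+[m/n]*n q (suc p))))

  ratio-cross : ∀ a b c d → 0 < b → 0 < d → c * b ≡ d * a → ratio a b ≡ ratio c d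
  ratio-cross a (suc b) c (suc d) _ _ eq = ℚ.fromℚᵘ-cong {mkℚᵘ (+ a) b} {mkℚᵘ (+ c) d} (*≡* (begin
    + a *ℤ + suc d  ≡⟨ ℤ.pos-* a (suc d) ⟨
    + (a * suc d)   ≡⟨ cong +_ (trans (*-comm a (suc d)) (sym eq)) ⟩
    + (c * suc b)   ≡⟨ ℤ.pos-* c (suc b) ⟩
    + c *ℤ + suc b  ∎))
    where open ≡-Reasoning

  num<den : ∀ {p d} .{c : Coprime (suc p) (suc d)} → mkℚ (+ suc p) d c <ℚ 1ℚ → suc p < suc d
  num<den {p} {d} (*<* (+<+ lt)) = subst₂ _<_ (*-identityʳ (suc p)) (+-identityʳ (suc d)) lt

  cf-canonical : ∀ r → 0ℚ <ℚ r → r <ℚ 1ℚ → Canonical (cf r)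
  cf-canonical (mkℚ (+ zero) d c) (*<* (+<+ ())) _
  cf-canonical (mkℚ (+ suc p) d c) _ r<1 =
    expand-canonical (suc d) (suc p) (suc d) (s≤s z≤n) (num<den r<1) (<⇒≤ (num<den r<1))

  cfVal-cf : ∀ r → 0ℚ <ℚ r → r <ℚ 1ℚ → cfVal (cf r) ≡ r
  cfVal-cf (mkℚ (+ zero) d c) (*<* (+<+ ())) _
  cfVal-cf r@(mkℚ (+ suc p) d c) 0<r r<1 with cfFrac-bounds (cf-canonical r 0<r r<1)
  ... | 0<num , num<den′ =
    trans (ratio-cross (cfNum (cf r)) (cfDen (cf r)) (suc p) (suc d) (<-trans 0<num num<den′) (s≤s z≤n)
             (expand-cross (suc d) (suc p) (suc d) (<⇒≤ (num<den r<1))))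
          (ℚ.normalize-coprime c)

  θ-canonical : ∀ {l} → Positive l → Canonical (θ l)
  θ-canonical (1≤a ∷ []) = [ s≤s 1≤a ]
  θ-canonical (1≤a ∷ (1≤b ∷ ps)) = 1≤a ∷ θ-canonical (1≤b ∷ ps)

  cfFrac-∷ʳ-1 : ∀ a l → cfFrac ((a ∷ l) ∷ʳ 1) ≡ cfFrac (θ (a ∷ l))
  cfFrac-∷ʳ-1 a [] = cong (1 ,_) (merge a)
    where
    merge : ∀ a → a * 1 + 1 ≡ suc a * 1 + 0
    merge = solve-∀
  cfFrac-∷ʳ-1 a (b ∷ l) = cong (λ f → proj₂ f , a * proj₂ f + proj₁ f) (cfFrac-∷ʳ-1 b l)

  cfVal-∷ʳ-1 : ∀ {l} → Positive l → cfVal (l ∷ʳ 1) ≡ cfVal (θ l)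
  cfVal-∷ʳ-1 {a ∷ l} _ = cong (λ f → ratio (proj₁ f) (proj₂ f)) (cfFrac-∷ʳ-1 a l)

  Kcf : List ℕ → List ℕ
  Kcf (1 ∷ []) = []
  Kcf (1 ∷ b ∷ r) = suc b ∷ r
  Kcf (suc (suc e) ∷ r) = 1 ∷ suc e ∷ r
  Kcf l = l

  cfFrac-Kcf : ∀ h r → 1 ≤ h → cfFrac (Kcf (h ∷ r)) ≡ (cfDen (h ∷ r) ∸ cfNum (h ∷ r) , cfDen (h ∷ r))
  cfFrac-Kcf 1 [] _ = refl
  cfFrac-Kcf 1 (b ∷ r) _ = sym (cong₂ _,_ (cancel (b * cfDen r + cfNum r) (cfDen r)) (absorb b (cfDen r) (cfNum r)))
    where
    cancel : ∀ x q → 1 * x + q ∸ x ≡ q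
    cancel x q = trans (cong (λ y → y + q ∸ x) (*-identityˡ x)) (m+n∸m≡n x q)
    absorb : ∀ b q p → 1 * (b * q + p) + q ≡ suc b * q + p
    absorb = solve-∀
  cfFrac-Kcf (suc (suc e)) r _ = cong₂ _,_
    (sym (trans (cong (_∸ cfDen r) (+-assoc (cfDen r) (suc e * cfDen r) (cfNum r))) (m+n∸m≡n (cfDen r) _)))
    (split e (cfDen r) (cfNum r))
    where
    split : ∀ e q p → 1 * (suc e * q + p) + q ≡ suc (suc e) * q + p
    split = solve-∀

  K-ratio : ∀ p q → 0 < q → p ≤ q → K (ratio p q) ≡ ratio (q ∸ p) q
  K-ratio p (suc q) _ p≤q = ℚ.toℚᵘ-injective (begin-equality
    toℚᵘ (1ℚ - X)                         ≃⟨ ℚ.toℚᵘ-homo-+ 1ℚ (- X) ⟩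
    toℚᵘ 1ℚ +ᵘ toℚᵘ (- X)                 ≃⟨ ℚᵘ.+-congʳ (toℚᵘ 1ℚ) (ℚ.toℚᵘ-homo‿- X) ⟩
    toℚᵘ 1ℚ +ᵘ -ᵘ toℚᵘ X                  ≃⟨ ℚᵘ.+-congʳ (toℚᵘ 1ℚ) (ℚᵘ.-‿cong (ℚ.toℚᵘ-fromℚᵘ (mkℚᵘ (+ p) q))) ⟩
    1ℚᵘ +ᵘ -ᵘ mkℚᵘ (+ p) q                ≃⟨ *≡* (cong₂ _*ℤ_ numerator denominator) ⟩
    mkℚᵘ (+ (suc q ∸ p)) q                ≃⟨ ℚ.toℚᵘ-fromℚᵘ (mkℚᵘ (+ (suc q ∸ p)) q) ⟨
    toℚᵘ (ratio (suc q ∸ p) (suc q))      ∎)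
    where
    open ℚᵘ.≤-Reasoning
    X : ℚ
    X = ratio p (suc q)
    numerator : ↥ (1ℚᵘ +ᵘ -ᵘ mkℚᵘ (+ p) q) ≡ + (suc q ∸ p)
    numerator = trans (simplify (+ suc q) (+ p)) (trans (ℤ.m-n≡m⊖n (suc q) p) (ℤ.⊖-≥ p≤q))
      where
      simplify : ∀ a b → + 1 *ℤ a +ℤ (-ℤ b) *ℤ + 1 ≡ a +ℤ -ℤ b
      simplify = solve-∀ℤ
    denominator : + suc q ≡ ↧ (1ℚᵘ +ᵘ -ᵘ mkℚᵘ (+ p) q)
    denominator = cong (λ n → + suc n) (sym (+-identityʳ q))

  cfDen-positive : ∀ {l} → All (1 ≤_) l → 1 ≤ cfDen l
  cfDen-positive [] = s≤s z≤n
  cfDen-positive {suc h ∷ l} (_ ∷ ps) = ≤-trans (cfDen-positive ps) (≤-trans (m≤m+n (cfDen l) (h * cfDen l)) (m≤m+n _ (cfNum l)))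

  K-cfVal : ∀ {l} → Positive l → K (cfVal l) ≡ cfVal (Kcf l)
  K-cfVal {suc h ∷ r} (1≤h ∷ ps) = begin
    K (ratio (cfNum l) (cfDen l))             ≡⟨ K-ratio (cfNum l) (cfDen l) (cfDen-positive (1≤h ∷ ps)) num≤den ⟩
    ratio (cfDen l ∸ cfNum l) (cfDen l)       ≡⟨ cong (λ f → ratio (proj₁ f) (proj₂ f)) (cfFrac-Kcf (suc h) r 1≤h) ⟨
    cfVal (Kcf l)                             ∎
    where
    open ≡-Reasoning
    l : List ℕ
    l = suc h ∷ r
    num≤den : cfNum l ≤ cfDen l
    num≤den = ≤-trans (m≤m+n (cfDen r) (h * cfDen r)) (m≤m+n _ (cfNum r))


module Words where

  open import Data.Nat using (ℕ; zero; suc; _+_; _∸_; _≤_; s≤s; z≤n)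
  open import Data.Nat.Properties using (+-suc; +-comm; +-identityʳ; ≤-trans; m≤n+m)
  open import Data.List using (List; []; _∷_; _++_; _∷ʳ_; replicate; reverse; map)
  open import Data.List.Properties
    using (++-assoc; ++-identityʳ; map-++; reverse-++; unfold-reverse; reverse-map)
  open import Data.List.Relation.Unary.All using (All; []; _∷_; universal)
  open import Data.List.Relation.Unary.All.Properties using (map⁺)
  open import Data.Product using (∃; ∃₂; _,_)
  open import Data.Integer using (_⊖_)
  open import Relation.Binary.PropositionalEquality
  open ≡-Reasoning
  open import Defs using (Tok; ones; ent; reduce; reduceE; buildTail; Jcf)
  open Expansions using (Positive; _∷_)

  -- glue is a block 1₋₁, which merges the entries on either side of it.
  data Letter : Set where
    one two glue : Letter

  mutual
    reduceWord : List Letter → List ℕ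
    reduceWord [] = []
    reduceWord (one ∷ w) = 1 ∷ reduceWord w
    reduceWord (two ∷ w) = reducePending 2 w
    reduceWord (glue ∷ w) = reduceWord w

    reducePending : ℕ → List Letter → List ℕ
    reducePending m (glue ∷ two ∷ w) = reducePending (suc m) w
    reducePending m w = m ∷ reduceWord w

  -- The block 1_{d-2} of the word of J; a block 1₋₂ (d = 0) is deleted, as in reduce.
  block : ℕ → List Letter
  block 0 = []
  block 1 = glue ∷ []
  block (suc (suc k)) = replicate k one

  middle : List ℕ → List Letter
  middle [] = []
  middle (d ∷ ds) = block d ++ two ∷ middle ds

  word : ℕ → List ℕ → ℕ → List Letter
  word a mid b = replicate a one ++ two ∷ middle mid ++ replicate b one

  glued : ℕ → List Letter
  glued zero = []
  glued (suc j) = glue ∷ two ∷ glued j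

  data Chunk : Set where
    single : Chunk
    run : ℕ → Chunk

  chunkWord : Chunk → List Letter
  chunkWord single = one ∷ []
  chunkWord (run j) = two ∷ glued j

  chunkValue : Chunk → ℕ
  chunkValue single = 1
  chunkValue (run j) = j + 2

  chunksWord : List Chunk → List Letter
  chunksWord [] = []
  chunksWord (c ∷ cs) = chunkWord c ++ chunksWord cs

  reducePending-glued : ∀ j m w → reducePending m (glued j ++ w) ≡ reducePending (j + m) w
  reducePending-glued zero m w = refl
  reducePending-glued (suc j) m w = trans (reducePending-glued j (suc m) w) (cong (λ k → reducePending k w) (+-suc j m))

  reducePending-chunksWord : ∀ m cs → reducePending m (chunksWord cs) ≡ m ∷ reduceWord (chunksWord cs)
  reducePending-chunksWord m [] = refl
  reducePending-chunksWord m (single ∷ cs) = refl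
  reducePending-chunksWord m (run j ∷ cs) = refl

  reduceWord-chunksWord : ∀ cs → reduceWord (chunksWord cs) ≡ map chunkValue cs
  reduceWord-chunksWord [] = refl
  reduceWord-chunksWord (single ∷ cs) = cong (1 ∷_) (reduceWord-chunksWord cs)
  reduceWord-chunksWord (run j ∷ cs) = begin
    reducePending 2 (glued j ++ chunksWord cs)  ≡⟨ reducePending-glued j 2 (chunksWord cs) ⟩
    reducePending (j + 2) (chunksWord cs)       ≡⟨ reducePending-chunksWord (j + 2) cs ⟩
    j + 2 ∷ reduceWord (chunksWord cs)          ≡⟨ cong (j + 2 ∷_) (reduceWord-chunksWord cs) ⟩
    j + 2 ∷ map chunkValue cs                   ∎

  chunksWord-++ : ∀ cs ds → chunksWord (cs ++ ds) ≡ chunksWord cs ++ chunksWord ds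
  chunksWord-++ [] ds = refl
  chunksWord-++ (c ∷ cs) ds = trans (cong (chunkWord c ++_) (chunksWord-++ cs ds)) (sym (++-assoc (chunkWord c) (chunksWord cs) (chunksWord ds)))

  chunksWord-singles : ∀ k → chunksWord (replicate k single) ≡ replicate k one
  chunksWord-singles zero = refl
  chunksWord-singles (suc k) = cong (one ∷_) (chunksWord-singles k)

  Chunked : List Letter → Set
  Chunked w = ∃ λ cs → w ≡ chunksWord cs

  singles-++-chunked : ∀ k {w} → Chunked w → Chunked (replicate k one ++ w)
  singles-++-chunked k (cs , refl) =
    replicate k single ++ cs ,
    trans (cong (_++ chunksWord cs) (sym (chunksWord-singles k))) (sym (chunksWord-++ (replicate k single) cs))

  glued-++-glue : ∀ j w → glued j ++ glue ∷ two ∷ w ≡ glued (suc j) ++ w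
  glued-++-glue zero w = refl
  glued-++-glue (suc j) w = cong (λ v → glue ∷ two ∷ v) (glued-++-glue j w)

  run-++-chunked : ∀ j mid b → Chunked (chunkWord (run j) ++ middle mid ++ replicate b one)
  run-++-chunked j [] b = run j ∷ replicate b single , cong (λ w → two ∷ glued j ++ w) (sym (chunksWord-singles b))
  run-++-chunked j (zero ∷ ds) b with run-++-chunked 0 ds b
  ... | cs , eq = run j ∷ cs , cong (λ w → two ∷ glued j ++ w) eq
  run-++-chunked j (suc zero ∷ ds) b with run-++-chunked (suc j) ds b
  ... | cs , eq = cs , trans (cong (two ∷_) (glued-++-glue j _)) eq
  run-++-chunked j (suc (suc k) ∷ ds) b with singles-++-chunked k (run-++-chunked 0 ds b)
  ... | cs , eq = run j ∷ cs ,
    cong (λ w → two ∷ glued j ++ w) (trans (++-assoc (replicate k one) (two ∷ middle ds) (replicate b one)) eq)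

  word-chunked : ∀ a mid b → Chunked (word a mid b)
  word-chunked a mid b = singles-++-chunked a (run-++-chunked 0 mid b)

  reduceWord-∷ʳ-one : ∀ {w} → Chunked w → reduceWord (w ∷ʳ one) ≡ reduceWord w ∷ʳ 1
  reduceWord-∷ʳ-one (cs , refl) = begin
    reduceWord (chunksWord cs ++ chunksWord (single ∷ [])) ≡⟨ cong reduceWord (sym (chunksWord-++ cs (single ∷ []))) ⟩
    reduceWord (chunksWord (cs ∷ʳ single))                 ≡⟨ reduceWord-chunksWord (cs ∷ʳ single) ⟩
    map chunkValue (cs ∷ʳ single)                          ≡⟨ map-++ chunkValue cs (single ∷ []) ⟩
    map chunkValue cs ∷ʳ 1                                 ≡⟨ cong (_∷ʳ 1) (sym (reduceWord-chunksWord cs)) ⟩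
    reduceWord (chunksWord cs) ∷ʳ 1                        ∎

  replicate-suc-∷ʳ : ∀ {A : Set} k (x : A) → replicate (suc k) x ≡ replicate k x ∷ʳ x
  replicate-suc-∷ʳ zero x = refl
  replicate-suc-∷ʳ (suc k) x = cong (x ∷_) (replicate-suc-∷ʳ k x)

  reverse-replicate : ∀ {A : Set} k (x : A) → reverse (replicate k x) ≡ replicate k x
  reverse-replicate zero x = refl
  reverse-replicate (suc k) x = begin
    reverse (x ∷ replicate k x)  ≡⟨ unfold-reverse x (replicate k x) ⟩
    reverse (replicate k x) ∷ʳ x ≡⟨ cong (_∷ʳ x) (reverse-replicate k x) ⟩
    replicate k x ∷ʳ x           ≡⟨ replicate-suc-∷ʳ k x ⟨
    replicate (suc k) x          ∎

  reverse-run : ∀ j → reverse (chunkWord (run j)) ≡ chunkWord (run j)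
  reverse-run zero = refl
  reverse-run (suc j) = begin
    reverse ((two ∷ glue ∷ []) ++ two ∷ glued j)           ≡⟨ reverse-++ (two ∷ glue ∷ []) (two ∷ glued j) ⟩
    reverse (two ∷ glued j) ++ glue ∷ two ∷ []             ≡⟨ cong (_++ glue ∷ two ∷ []) (reverse-run j) ⟩
    two ∷ glued j ++ glue ∷ two ∷ []                       ≡⟨ cong (two ∷_) (glued-++-glue j []) ⟩
    two ∷ glued (suc j) ++ []                              ≡⟨ cong (two ∷_) (++-identityʳ (glued (suc j))) ⟩
    chunkWord (run (suc j))                                ∎

  reverse-chunkWord : ∀ c → reverse (chunkWord c) ≡ chunkWord c
  reverse-chunkWord single = refl
  reverse-chunkWord (run j) = reverse-run j

  reverse-chunksWord : ∀ cs → reverse (chunksWord cs) ≡ chunksWord (reverse cs)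
  reverse-chunksWord [] = refl
  reverse-chunksWord (c ∷ cs) = begin
    reverse (chunkWord c ++ chunksWord cs)            ≡⟨ reverse-++ (chunkWord c) (chunksWord cs) ⟩
    reverse (chunksWord cs) ++ reverse (chunkWord c)  ≡⟨ cong₂ _++_ (reverse-chunksWord cs) (trans (reverse-chunkWord c) (sym (++-identityʳ (chunkWord c)))) ⟩
    chunksWord (reverse cs) ++ chunksWord (c ∷ [])    ≡⟨ chunksWord-++ (reverse cs) (c ∷ []) ⟨
    chunksWord (reverse cs ∷ʳ c)                      ≡⟨ cong chunksWord (unfold-reverse c cs) ⟨
    chunksWord (reverse (c ∷ cs))                     ∎

  reduceWord-reverse : ∀ {w} → Chunked w → reduceWord (reverse w) ≡ reverse (reduceWord w)
  reduceWord-reverse (cs , refl) = begin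
    reduceWord (reverse (chunksWord cs))  ≡⟨ cong reduceWord (reverse-chunksWord cs) ⟩
    reduceWord (chunksWord (reverse cs))  ≡⟨ reduceWord-chunksWord (reverse cs) ⟩
    map chunkValue (reverse cs)           ≡⟨ reverse-map chunkValue cs ⟩
    reverse (map chunkValue cs)           ≡⟨ cong reverse (reduceWord-chunksWord cs) ⟨
    reverse (reduceWord (chunksWord cs))  ∎

  word-∷ʳ-one : ∀ a mid b → word a mid (suc b) ≡ word a mid b ∷ʳ one
  word-∷ʳ-one a mid b = begin
    replicate a one ++ two ∷ middle mid ++ replicate (suc b) one
      ≡⟨ cong (λ w → replicate a one ++ two ∷ middle mid ++ w) (replicate-suc-∷ʳ b one) ⟩
    replicate a one ++ (two ∷ middle mid ++ replicate b one ∷ʳ one)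
      ≡⟨ cong (λ w → replicate a one ++ two ∷ w) (++-assoc (middle mid) (replicate b one) (one ∷ [])) ⟨
    replicate a one ++ ((two ∷ middle mid ++ replicate b one) ∷ʳ one)
      ≡⟨ ++-assoc (replicate a one) (two ∷ middle mid ++ replicate b one) (one ∷ []) ⟨
    word a mid b ∷ʳ one ∎

  reverse-block : ∀ d → reverse (block d) ≡ block d
  reverse-block zero = refl
  reverse-block (suc zero) = refl
  reverse-block (suc (suc k)) = reverse-replicate k one

  middle-∷ʳ : ∀ ds d → middle (ds ∷ʳ d) ≡ middle ds ++ block d ++ two ∷ []
  middle-∷ʳ [] d = refl
  middle-∷ʳ (e ∷ ds) d = trans (cong (λ w → block e ++ two ∷ w) (middle-∷ʳ ds d))
    (sym (++-assoc (block e) (two ∷ middle ds) (block d ++ two ∷ [])))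

  reverse-two-middle : ∀ mid → reverse (two ∷ middle mid) ≡ two ∷ middle (reverse mid)
  reverse-two-middle [] = refl
  reverse-two-middle (d ∷ ds) = begin
    reverse ((two ∷ block d) ++ two ∷ middle ds)          ≡⟨ reverse-++ (two ∷ block d) (two ∷ middle ds) ⟩
    reverse (two ∷ middle ds) ++ reverse (two ∷ block d)  ≡⟨ cong₂ _++_ (reverse-two-middle ds) (unfold-reverse two (block d)) ⟩
    two ∷ middle (reverse ds) ++ reverse (block d) ∷ʳ two ≡⟨ cong (λ w → two ∷ middle (reverse ds) ++ w ∷ʳ two) (reverse-block d) ⟩
    two ∷ middle (reverse ds) ++ block d ∷ʳ two           ≡⟨ cong (two ∷_) (middle-∷ʳ (reverse ds) d) ⟨
    two ∷ middle (reverse ds ∷ʳ d)                        ≡⟨ cong (λ ds′ → two ∷ middle ds′) (unfold-reverse d ds) ⟨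
    two ∷ middle (reverse (d ∷ ds))                       ∎

  reverse-word : ∀ a mid b → reverse (word a mid b) ≡ word b (reverse mid) a
  reverse-word a mid b = begin
    reverse (replicate a one ++ (two ∷ middle mid) ++ replicate b one)
      ≡⟨ reverse-++ (replicate a one) ((two ∷ middle mid) ++ replicate b one) ⟩
    reverse ((two ∷ middle mid) ++ replicate b one) ++ reverse (replicate a one)
      ≡⟨ cong₂ _++_ (reverse-++ (two ∷ middle mid) (replicate b one)) (reverse-replicate a one) ⟩
    (reverse (replicate b one) ++ reverse (two ∷ middle mid)) ++ replicate a one
      ≡⟨ cong₂ (λ u v → (u ++ v) ++ replicate a one) (reverse-replicate b one) (reverse-two-middle mid) ⟩
    (replicate b one ++ two ∷ middle (reverse mid)) ++ replicate a one
      ≡⟨ ++-assoc (replicate b one) (two ∷ middle (reverse mid)) (replicate a one) ⟩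
    word b (reverse mid) a ∎

  reduceWord-word-∷ʳ-one : ∀ a mid b → reduceWord (word a mid (suc b)) ≡ reduceWord (word a mid b) ∷ʳ 1
  reduceWord-word-∷ʳ-one a mid b =
    trans (cong reduceWord (word-∷ʳ-one a mid b)) (reduceWord-∷ʳ-one (word-chunked a mid b))

  reduceWord-word-reverse : ∀ a mid b → reduceWord (word b (reverse mid) a) ≡ reverse (reduceWord (word a mid b))
  reduceWord-word-reverse a mid b =
    trans (cong reduceWord (sym (reverse-word a mid b))) (reduceWord-reverse (word-chunked a mid b))

  reducePending-head : ∀ w → ∃₂ λ j r → ∀ m → reducePending m w ≡ m + j ∷ r
  reducePending-head (glue ∷ two ∷ w) with reducePending-head w
  ... | j , r , eq = suc j , r , λ m → trans (eq (suc m)) (cong (_∷ r) (sym (+-suc m j)))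
  reducePending-head []                 = 0 , _ , λ m → cong (_∷ _) (sym (+-identityʳ m))
  reducePending-head (one ∷ w)          = 0 , _ , λ m → cong (_∷ _) (sym (+-identityʳ m))
  reducePending-head (two ∷ w)          = 0 , _ , λ m → cong (_∷ _) (sym (+-identityʳ m))
  reducePending-head (glue ∷ [])        = 0 , _ , λ m → cong (_∷ _) (sym (+-identityʳ m))
  reducePending-head (glue ∷ one ∷ w)   = 0 , _ , λ m → cong (_∷ _) (sym (+-identityʳ m))
  reducePending-head (glue ∷ glue ∷ w)  = 0 , _ , λ m → cong (_∷ _) (sym (+-identityʳ m))

  chunkValue-positive : ∀ c → 1 ≤ chunkValue c
  chunkValue-positive single = s≤s z≤n
  chunkValue-positive (run j) = ≤-trans (s≤s z≤n) (m≤n+m 2 j)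

  reduceWord-positive : ∀ {w} → Chunked w → All (1 ≤_) (reduceWord w)
  reduceWord-positive (cs , refl) =
    subst (All (1 ≤_)) (sym (reduceWord-chunksWord cs)) (map⁺ (universal chunkValue-positive cs))

  reduceWord-word-nonempty : ∀ a mid b → ∃₂ λ h r → reduceWord (word a mid b) ≡ h ∷ r
  reduceWord-word-nonempty zero mid b with reducePending-head (middle mid ++ replicate b one)
  ... | j , r , eq = _ , _ , eq 2
  reduceWord-word-nonempty (suc a) mid b = _ , _ , refl

  reduceWord-word-positive : ∀ a mid b → Positive (reduceWord (word a mid b))
  reduceWord-word-positive a mid b with reduceWord-word-nonempty a mid b
  ... | h , r , eq with subst (All (1 ≤_)) eq (reduceWord-positive (word-chunked a mid b))
  ... | p ∷ ps = subst Positive (sym eq) (p ∷ ps)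

  reduceWord-ones : ∀ k → reduceWord (replicate k one) ≡ replicate k 1
  reduceWord-ones zero = refl
  reduceWord-ones (suc k) = cong (1 ∷_) (reduceWord-ones k)

  reduceWord-ones-++ : ∀ k w → reduceWord (replicate k one ++ w) ≡ replicate k 1 ++ reduceWord w
  reduceWord-ones-++ zero w = refl
  reduceWord-ones-++ (suc k) w = cong (1 ∷_) (reduceWord-ones-++ k w)

  reducePending-ones : ∀ m k → reducePending m (replicate k one) ≡ m ∷ replicate k 1
  reducePending-ones m zero = refl
  reducePending-ones m (suc k) = cong (λ r → m ∷ 1 ∷ r) (reduceWord-ones k)

  reducePending-ones-two : ∀ m k w →
    reducePending m (replicate k one ++ two ∷ w) ≡ m ∷ reduceWord (replicate k one ++ two ∷ w)
  reducePending-ones-two m zero w = refl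
  reducePending-ones-two m (suc k) w = refl

  tailTokens : List ℕ → List Tok
  tailTokens [] = []
  tailTokens (n ∷ ns) = buildTail n ns

  tailTokens-∷ : ∀ d ds c → tailTokens (d ∷ ds ++ c ∷ []) ≡ ones (d ⊖ 2) ∷ ent 2 ∷ tailTokens (ds ++ c ∷ [])
  tailTokens-∷ d [] c = refl
  tailTokens-∷ d (e ∷ ds) c = refl

  reduceE-tailTokens : ∀ mid c m →
    reduceE m (tailTokens (mid ++ c ∷ [])) ≡ reducePending m (middle mid ++ replicate (c ∸ 1) one)
  reduceE-tailTokens [] zero m = refl
  reduceE-tailTokens [] (suc c) m = trans (cong (m ∷_) (++-identityʳ (replicate c 1))) (sym (reducePending-ones m c))
  reduceE-tailTokens (d ∷ ds) c m rewrite tailTokens-∷ d ds c = by-block d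
    where
    R : List Letter
    R = replicate (c ∸ 1) one
    by-block : ∀ d → reduceE m (ones (d ⊖ 2) ∷ ent 2 ∷ tailTokens (ds ++ c ∷ [])) ≡
                     reducePending m ((block d ++ two ∷ middle ds) ++ R)
    by-block zero = cong (m ∷_) (reduceE-tailTokens ds c 2)
    by-block (suc zero) =
      trans (cong (λ k → reduceE (k ∸ 1) (tailTokens (ds ++ c ∷ []))) (+-comm m 2)) (reduceE-tailTokens ds c (suc m))
    by-block (suc (suc k)) = begin
      m ∷ (replicate k 1 ++ reduceE 2 (tailTokens (ds ++ c ∷ [])))
        ≡⟨ cong (λ r → m ∷ (replicate k 1 ++ r)) (reduceE-tailTokens ds c 2) ⟩
      m ∷ (replicate k 1 ++ reduceWord (two ∷ middle ds ++ R))
        ≡⟨ cong (m ∷_) (reduceWord-ones-++ k _) ⟨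
      m ∷ reduceWord (replicate k one ++ two ∷ middle ds ++ R)
        ≡⟨ reducePending-ones-two m k _ ⟨
      reducePending m (replicate k one ++ two ∷ middle ds ++ R)
        ≡⟨ cong (reducePending m) (++-assoc (replicate k one) (two ∷ middle ds) R) ⟨
      reducePending m ((replicate k one ++ two ∷ middle ds) ++ R) ∎

  Jcf-word : ∀ a mid c → Jcf (a ∷ mid ++ c ∷ []) ≡ reduceWord (word (a ∸ 1) mid (c ∸ 1))
  Jcf-word a mid c = trans (as-tokens mid) (leading a)
    where
    as-tokens : ∀ mid → Jcf (a ∷ mid ++ c ∷ []) ≡ reduce (ones (a ⊖ 1) ∷ ent 2 ∷ tailTokens (mid ++ c ∷ []))
    as-tokens [] = refl
    as-tokens (d ∷ ds) = refl
    leading : ∀ a → reduce (ones (a ⊖ 1) ∷ ent 2 ∷ tailTokens (mid ++ c ∷ [])) ≡ reduceWord (word (a ∸ 1) mid (c ∸ 1))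
    leading zero = reduceE-tailTokens mid c 2
    leading (suc a) = trans (cong (replicate a 1 ++_) (reduceE-tailTokens mid c 2)) (sym (reduceWord-ones-++ a _))


module Commutation where

  open import Function using (_∘_)
  open import Data.Nat using (ℕ; zero; suc; _+_; _≤_; z≤n; s≤s)
  open import Data.Nat.Properties using (≤-trans)
  open import Data.List using (List; []; _∷_; _++_; _∷ʳ_; replicate; reverse)
  open import Data.List.Properties using (++-identityʳ; ++-assoc; reverse-++; unfold-reverse)
  open import Data.List.Relation.Unary.All using (All; []; _∷_)
  open import Data.List.Relation.Unary.All.Properties using (∷ʳ⁺) renaming (replicate⁺ to All-replicate)
  open import Data.Product using (_,_)
  open import Relation.Binary.PropositionalEquality hiding (J)
  open ≡-Reasoning
  open import Defs
  open Expansions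
  open Words

  All-reverse : ∀ {A : Set} {P : A → Set} {xs} → All P xs → All P (reverse xs)
  All-reverse {xs = []} [] = []
  All-reverse {P = P} {x ∷ xs} (p ∷ ps) = subst (All P) (sym (unfold-reverse x xs)) (∷ʳ⁺ (All-reverse ps) p)

  θ-∷ʳ : ∀ xs c → θ (xs ∷ʳ c) ≡ xs ∷ʳ suc c
  θ-∷ʳ [] c = refl
  θ-∷ʳ (a ∷ []) c = refl
  θ-∷ʳ (a ∷ b ∷ xs) c = cong (a ∷_) (θ-∷ʳ (b ∷ xs) c)

  θinv-θ : ∀ l → θinv (θ l) ≡ l
  θinv-θ [] = refl
  θinv-θ (a ∷ []) = refl
  θinv-θ (a ∷ b ∷ []) = refl
  θinv-θ (a ∷ b ∷ c ∷ l) = cong (a ∷_) (θinv-θ (b ∷ c ∷ l))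

  φcf-θ : ∀ l → φcf (θ l) ≡ θ (reverse l)
  φcf-θ l = cong (θ ∘ reverse) (θinv-θ l)

  data Shape : List ℕ → Set where
    single : ∀ k → Shape (suc (suc k) ∷ [])
    long   : ∀ a mid c → All (1 ≤_) mid → Shape (suc a ∷ mid ++ suc (suc c) ∷ [])

  shape : ∀ {n} → Canonical n → Shape n
  shape [ s≤s (s≤s _) ] = single _
  shape (_∷_ {suc a} _ v) with shape v
  ... | single k = long a [] k []
  ... | long b mid c ps = long a (suc b ∷ mid) c (s≤s z≤n ∷ ps)

  long-canonical : ∀ a mid c → All (1 ≤_) mid → Canonical (suc a ∷ mid ++ suc (suc c) ∷ [])
  long-canonical a [] c [] = s≤s z≤n ∷ [ s≤s (s≤s z≤n) ]
  long-canonical a (suc d ∷ ds) c (_ ∷ ps) = s≤s z≤n ∷ long-canonical d ds c ps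

  canonical-positive : ∀ {n} → Canonical n → Positive n
  canonical-positive [ 2≤a ] = ≤-trans (s≤s z≤n) 2≤a ∷ []
  canonical-positive (1≤a ∷ v) with canonical-positive v
  ... | 1≤b ∷ ps = 1≤a ∷ 1≤b ∷ ps

  Jcf-positive : ∀ {n} → Canonical n → Positive (Jcf n)
  Jcf-positive v with shape v
  ... | single k = s≤s z≤n ∷ All-replicate (suc k) (s≤s z≤n)
  ... | long a mid c _ = subst Positive (sym (Jcf-word (suc a) mid (suc (suc c)))) (reduceWord-word-positive a mid (suc c))

  J-cfVal : ∀ {n} → Canonical n → J (cfVal n) ≡ cfVal (Jcf n)
  J-cfVal v = cong (cfVal ∘ Jcf) (cf-cfVal v)

  φ-cfVal : ∀ {n} → Canonical n → φ (cfVal n) ≡ cfVal (φcf n)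
  φ-cfVal v = cong (cfVal ∘ φcf) (cf-cfVal v)

  φ-θ : ∀ {l} → Positive l → φ (cfVal (θ l)) ≡ cfVal (θ (reverse l))
  φ-θ {l} p = trans (φ-cfVal (θ-canonical p)) (cong cfVal (φcf-θ l))

  φcf-long : ∀ a mid c → φcf (suc a ∷ mid ++ suc (suc c) ∷ []) ≡ suc c ∷ reverse mid ++ suc (suc a) ∷ []
  φcf-long a mid c = begin
    φcf (m ∷ʳ suc (suc c))                   ≡⟨ cong φcf (θ-∷ʳ m (suc c)) ⟨
    φcf (θ (m ∷ʳ suc c))                     ≡⟨ φcf-θ (m ∷ʳ suc c) ⟩
    θ (reverse (m ∷ʳ suc c))                 ≡⟨ cong θ (reverse-++ m (suc c ∷ [])) ⟩
    θ (suc c ∷ reverse m)                    ≡⟨ cong (θ ∘ (suc c ∷_)) (unfold-reverse (suc a) mid) ⟩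
    θ ((suc c ∷ reverse mid) ∷ʳ suc a)       ≡⟨ θ-∷ʳ (suc c ∷ reverse mid) (suc a) ⟩
    suc c ∷ reverse mid ++ suc (suc a) ∷ []  ∎
    where
    m : List ℕ
    m = suc a ∷ mid

  J-single : ∀ k → J (cfVal (suc (suc k) ∷ [])) ≡ cfVal (θ (replicate (suc k) 1))
  J-single k = begin
    J (cfVal (suc (suc k) ∷ []))          ≡⟨ J-cfVal {suc (suc k) ∷ []} [ s≤s (s≤s z≤n) ] ⟩
    cfVal (replicate (suc (suc k)) 1)     ≡⟨ cong cfVal (replicate-suc-∷ʳ (suc k) 1) ⟩
    cfVal (replicate (suc k) 1 ∷ʳ 1)      ≡⟨ cfVal-∷ʳ-1 (s≤s z≤n ∷ All-replicate k (s≤s z≤n)) ⟩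
    cfVal (θ (replicate (suc k) 1))       ∎

  J-long : ∀ a mid c → All (1 ≤_) mid →
    J (cfVal (suc a ∷ mid ++ suc (suc c) ∷ [])) ≡ cfVal (θ (reduceWord (word a mid c)))
  J-long a mid c ps = begin
    J (cfVal (suc a ∷ mid ++ suc (suc c) ∷ []))  ≡⟨ J-cfVal (long-canonical a mid c ps) ⟩
    cfVal (Jcf (suc a ∷ mid ++ suc (suc c) ∷ [])) ≡⟨ cong cfVal (Jcf-word (suc a) mid (suc (suc c))) ⟩
    cfVal (reduceWord (word a mid (suc c)))       ≡⟨ cong cfVal (reduceWord-word-∷ʳ-one a mid c) ⟩
    cfVal (reduceWord (word a mid c) ∷ʳ 1)        ≡⟨ cfVal-∷ʳ-1 (reduceWord-word-positive a mid c) ⟩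
    cfVal (θ (reduceWord (word a mid c)))         ∎

  J-φ-cfVal : ∀ {n} → Canonical n → J (φ (cfVal n)) ≡ φ (J (cfVal n))
  J-φ-cfVal v with shape v
  ... | single k = begin
    J (φ (cfVal (suc (suc k) ∷ [])))         ≡⟨ cong J (φ-cfVal v) ⟩
    J (cfVal (suc (suc k) ∷ []))             ≡⟨ J-single k ⟩
    cfVal (θ (replicate (suc k) 1))          ≡⟨ cong (cfVal ∘ θ) (reverse-replicate (suc k) 1) ⟨
    cfVal (θ (reverse (replicate (suc k) 1))) ≡⟨ φ-θ (s≤s z≤n ∷ All-replicate k (s≤s z≤n)) ⟨
    φ (cfVal (θ (replicate (suc k) 1)))      ≡⟨ cong φ (J-single k) ⟨
    φ (J (cfVal (suc (suc k) ∷ [])))         ∎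
  ... | long a mid c ps = begin
    J (φ (cfVal (suc a ∷ mid ++ suc (suc c) ∷ [])))    ≡⟨ cong J (trans (φ-cfVal v) (cong cfVal (φcf-long a mid c))) ⟩
    J (cfVal (suc c ∷ reverse mid ++ suc (suc a) ∷ [])) ≡⟨ J-long c (reverse mid) a (All-reverse ps) ⟩
    cfVal (θ (reduceWord (word c (reverse mid) a)))     ≡⟨ cong (cfVal ∘ θ) (reduceWord-word-reverse a mid c) ⟩
    cfVal (θ (reverse (reduceWord (word a mid c))))     ≡⟨ φ-θ (reduceWord-word-positive a mid c) ⟨
    φ (cfVal (θ (reduceWord (word a mid c))))           ≡⟨ cong φ (J-long a mid c ps) ⟨
    φ (J (cfVal (suc a ∷ mid ++ suc (suc c) ∷ [])))    ∎

  Kcf-long-canonical : ∀ a mid c → All (1 ≤_) mid → Canonical (Kcf (suc a ∷ mid ++ suc (suc c) ∷ []))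
  Kcf-long-canonical zero [] c _ = [ s≤s (s≤s z≤n) ]
  Kcf-long-canonical zero (suc d ∷ ds) c (_ ∷ ps) = long-canonical (suc d) ds c ps
  Kcf-long-canonical (suc a) mid c ps = long-canonical 0 (suc a ∷ mid) c (s≤s z≤n ∷ ps)

  Jcf-Kcf-long : ∀ a mid c → All (1 ≤_) mid →
    Jcf (Kcf (suc a ∷ mid ++ suc (suc c) ∷ [])) ≡ Kcf (Jcf (suc a ∷ mid ++ suc (suc c) ∷ []))
  Jcf-Kcf-long zero [] c _ = cong (λ r → 1 ∷ 1 ∷ r) (sym (++-identityʳ (replicate (suc c) 1)))
  Jcf-Kcf-long zero (suc zero ∷ ds) c (_ ∷ _) with reducePending-head (middle ds ++ replicate (suc c) one)
  ... | j , r , head = begin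
    Jcf (2 ∷ ds ++ suc (suc c) ∷ [])                   ≡⟨ Jcf-word 2 ds (suc (suc c)) ⟩
    1 ∷ reducePending 2 (middle ds ++ replicate (suc c) one) ≡⟨ cong (1 ∷_) (head 2) ⟩
    Kcf (3 + j ∷ r)                                    ≡⟨ cong Kcf (head 3) ⟨
    Kcf (reducePending 3 (middle ds ++ replicate (suc c) one)) ≡⟨ cong Kcf (Jcf-word 1 (1 ∷ ds) (suc (suc c))) ⟨
    Kcf (Jcf (1 ∷ 1 ∷ ds ++ suc (suc c) ∷ []))         ∎
  Jcf-Kcf-long zero (suc (suc k) ∷ ds) c (_ ∷ _) = begin
    Jcf (suc (suc (suc k)) ∷ ds ++ suc (suc c) ∷ [])   ≡⟨ Jcf-word (suc (suc (suc k))) ds (suc (suc c)) ⟩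
    1 ∷ 1 ∷ reduceWord (replicate k one ++ two ∷ X)    ≡⟨ cong Kcf (reducePending-ones-two 2 k X) ⟨
    Kcf (reducePending 2 (replicate k one ++ two ∷ X)) ≡⟨ cong (Kcf ∘ reducePending 2) (++-assoc (replicate k one) (two ∷ middle ds) R) ⟨
    Kcf (reduceWord (word 0 (suc (suc k) ∷ ds) (suc c))) ≡⟨ cong Kcf (Jcf-word 1 (suc (suc k) ∷ ds) (suc (suc c))) ⟨
    Kcf (Jcf (1 ∷ suc (suc k) ∷ ds ++ suc (suc c) ∷ [])) ∎
    where
    R X : List Letter
    R = replicate (suc c) one
    X = middle ds ++ R
  Jcf-Kcf-long (suc zero) mid c _ with reducePending-head (middle mid ++ replicate (suc c) one)
  ... | j , r , head = begin
    Jcf (1 ∷ 1 ∷ mid ++ suc (suc c) ∷ [])                    ≡⟨ Jcf-word 1 (1 ∷ mid) (suc (suc c)) ⟩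
    reducePending 3 (middle mid ++ replicate (suc c) one)     ≡⟨ head 3 ⟩
    Kcf (1 ∷ 2 + j ∷ r)                                      ≡⟨ cong (Kcf ∘ (1 ∷_)) (head 2) ⟨
    Kcf (1 ∷ reducePending 2 (middle mid ++ replicate (suc c) one)) ≡⟨ cong Kcf (Jcf-word 2 mid (suc (suc c))) ⟨
    Kcf (Jcf (2 ∷ mid ++ suc (suc c) ∷ []))                  ∎
  Jcf-Kcf-long (suc (suc k)) mid c _ = begin
    Jcf (1 ∷ suc (suc k) ∷ mid ++ suc (suc c) ∷ [])     ≡⟨ Jcf-word 1 (suc (suc k) ∷ mid) (suc (suc c)) ⟩
    reduceWord (word 0 (suc (suc k) ∷ mid) (suc c))     ≡⟨ cong (reducePending 2) (++-assoc (replicate k one) (two ∷ middle mid) R) ⟩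
    reducePending 2 (replicate k one ++ two ∷ X)        ≡⟨ reducePending-ones-two 2 k X ⟩
    2 ∷ reduceWord (replicate k one ++ two ∷ X)         ≡⟨ cong Kcf (Jcf-word (suc (suc (suc k))) mid (suc (suc c))) ⟨
    Kcf (Jcf (suc (suc (suc k)) ∷ mid ++ suc (suc c) ∷ [])) ∎
    where
    R X : List Letter
    R = replicate (suc c) one
    X = middle mid ++ R

  Jcf-Kcf⇒J-K-cfVal : ∀ {n} → Canonical n → Canonical (Kcf n) → Jcf (Kcf n) ≡ Kcf (Jcf n) →
    J (K (cfVal n)) ≡ K (J (cfVal n))
  Jcf-Kcf⇒J-K-cfVal {n} v vK commute = begin
    J (K (cfVal n))      ≡⟨ cong J (K-cfVal (canonical-positive v)) ⟩
    J (cfVal (Kcf n))    ≡⟨ J-cfVal vK ⟩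
    cfVal (Jcf (Kcf n))  ≡⟨ cong cfVal commute ⟩
    cfVal (Kcf (Jcf n))  ≡⟨ K-cfVal (Jcf-positive v) ⟨
    K (cfVal (Jcf n))    ≡⟨ cong K (J-cfVal v) ⟨
    K (J (cfVal n))      ∎

  J-K-cfVal : ∀ {n} → Canonical n → J (K (cfVal n)) ≡ K (J (cfVal n))
  J-K-cfVal v with shape v
  -- Kcf (2 ∷ []) = 1 ∷ 1 ∷ [] is not canonical; both sides evaluate to 1/2.
  ... | single zero = refl
  ... | single (suc k) = Jcf-Kcf⇒J-K-cfVal v (s≤s z≤n ∷ [ s≤s (s≤s z≤n) ]) (cong (2 ∷_) (++-identityʳ (replicate (suc k) 1)))
  ... | long a mid c ps = Jcf-Kcf⇒J-K-cfVal v (Kcf-long-canonical a mid c ps) (Jcf-Kcf-long a mid c ps)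

open import Defs
open import Data.Product using (_×_; _,_)
open import Data.Rational using (ℚ; 0ℚ; 1ℚ; _<_)
open import Relation.Binary.PropositionalEquality using (_≡_; subst)
open Expansions using (Canonical; cf-canonical; cfVal-cf)
open Commutation using (J-φ-cfVal; J-K-cfVal)

mainTheorem3 : (r : ℚ) → 0ℚ < r → r < 1ℚ →
    (J (φ r) ≡ φ (J r)) × (J (K r) ≡ K (J r))
mainTheorem3 r 0<r r<1 =
  subst (λ x → (J (φ x) ≡ φ (J x)) × (J (K x) ≡ K (J x))) (cfVal-cf r 0<r r<1)
    (J-φ-cfVal canonical , J-K-cfVal canonical)
  where
  canonical : Canonical (cf r)
  canonical = cf-canonical r 0<r r<1
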